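{- Let $L$ be a large even integer with $\sqrt L$ an integer, let $V=\{v_1,v_2,v_3,v_4\}$ with all degree bounds $1$, and write a unit-weight job as (source, destination, size, release time). Let $\mathcal S_1$ consist of $\sqrt L$ jobs $(v_1,v_2,1,1)$, $\mathcal S_2$ of $\sqrt L$ jobs $(v_3,v_2,1,1)$, $\mathcal S_3=\{(v_3,v_4,1,\sqrt L+i): i\in[L]\}$, $\mathcal S_4=\{(v_1,v_4,1,\sqrt L+i): i\in[L]\}$, and let the instance be $\mathcal T_1=\mathcal S_1\cup\mathcal S_2\cup\mathcal S_3$ with probability $1/2$ and $\mathcal T_2=\mathcal S_1\cup\mathcal S_2\cup\mathcal S_4$ with probability $1/2$, so that the number of jobs is $n=L+2\sqrt L$. Then with probability $1$, the optimal (offline, speed-$1$) total flow time of the instance is $O(n)$.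
   Context: Time is slotted. In each slot a schedule processes a set of released uncompleted unit-size jobs forming a matching on $V$ (each node is an endpoint of at most one processed job); a processed job is completed. The total flow time is $\sum_i (c(i)-r_i)$ with $c(i)$ the completion time of job $i$. -}

module Defs where

open import Data.Nat using (ℕ; zero; suc; _+_; _*_; _∸_; _<_; _≤_)
open import Data.Fin using (Fin; zero; suc)
open import Data.List using (List; length; map; upTo; replicate; tabulate; _++_; lookup)
open import Data.Nat.ListAction using (sum)
open import Data.Product using (_×_; ∃; ∃-syntax)
open import Relation.Binary.PropositionalEquality using (_≡_; _≢_)

Node : Set
Node = Fin 4

v₁ v₂ v₃ v₄ : Node
v₁ = zero
v₂ = suc zero
v₃ = suc (suc zero)
v₄ = suc (suc (suc zero))

-- A unit-weight, unit-size job (source, destination, size 1, release time).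
record Job : Set where
  constructor job
  field
    src : Node
    dst : Node
    rel : ℕ
open Job public

Instance : Set
Instance = List Job

-- A schedule assigns to each job its completion time c(i):
-- job i is processed in the slot ending at time c(i).
Schedule : Instance → Set
Schedule J = Fin (length J) → ℕ

Disjoint : Job → Job → Set
Disjoint a b =
  (src a ≢ src b) × (src a ≢ dst b) × (dst a ≢ src b) × (dst a ≢ dst b)

-- Feasibility (speed 1, all degree bounds 1): each job is processed in a
-- slot after its release (r_i < c(i)), and the jobs processed in the same
-- slot form a matching on V.
Feasible : (J : Instance) → Schedule J → Set
Feasible J c =
  (∀ i → rel (lookup J i) < c i) ×
  (∀ i j → i ≢ j → c i ≡ c j → Disjoint (lookup J i) (lookup J j))

flowTime : (J : Instance) → Schedule J → ℕ
flowTime J c = sum (tabulate (λ i → c i ∸ rel (lookup J i)))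

OptAtMost : Instance → ℕ → Set
OptAtMost J B = ∃[ c ] (Feasible J c × flowTime J c ≤ B)

-- The instance families, parametrised by s = √L (so L = s * s).
S₁ S₂ S₃ S₄ : ℕ → Instance
S₁ s = replicate s (job v₁ v₂ 1)
S₂ s = replicate s (job v₃ v₂ 1)
S₃ s = map (λ i → job v₃ v₄ (s + suc i)) (upTo (s * s))   -- i ∈ [L] = {1..L}
S₄ s = map (λ i → job v₁ v₄ (s + suc i)) (upTo (s * s))

T₁ T₂ : ℕ → Instance
T₁ s = S₁ s ++ S₂ s ++ S₃ s
T₂ s = S₁ s ++ S₂ s ++ S₄ s

numJobs : ℕ → ℕ
numJobs s = s * s + 2 * s

module Submission where

open import Defs
open import Data.Nat using (ℕ; _*_; _≤_)
open import Data.Nat.Divisibility using (_∣_)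
open import Data.Product using (_×_; ∃; ∃-syntax)

open import Data.Nat using (zero; suc; _+_; _∸_; _<_; z≤n; s≤s; z<s; s<s)
open import Data.Nat.Properties
open import Data.Nat.ListAction using (sum)
open import Data.Nat.ListAction.Properties using (sum-++)
open import Data.Nat.Tactic.RingSolver using (solve-∀)
open import Data.Fin using (Fin; zero; suc)
open import Data.List using (List; []; _∷_; map; length; lookup; replicate; applyUpTo; upTo; _++_)
open import Data.List.Properties using (map-++; map-applyUpTo; map-upTo)
open import Data.List.Relation.Unary.All as All using (All; []; _∷_)
import Data.List.Relation.Unary.All.Properties as All
open import Data.List.Relation.Unary.AllPairs using (AllPairs; []; _∷_)
import Data.List.Relation.Unary.AllPairs.Properties as AllPairs
open import Data.Product using (_,_)
open import Data.Sum using (_⊎_; inj₁; inj₂)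
open import Data.Empty using (⊥-elim)
open import Function using (_∘_)
open import Relation.Binary.PropositionalEquality

-- With s = √L, one of the two size-s blocks S₁, S₂ is
-- processed in slots 2 … s+1, the other in slots s+2 … 2s+1, and every job
-- of the long stream (S₃ or S₄) is processed in the slot right after its
-- release.  The late block is chosen edge-disjoint from the stream (v₁v₂
-- against v₃v₄ for T₁, v₃v₂ against v₁v₄ for T₂), so the only jobs sharing
-- a slot never share an endpoint.  Each block job has flow time at most
-- 2s+2 and each stream job flow time 1, so the total is ≤ 5s² + 4s ≤ 5n.

record Timed : Set where
  constructor _at_
  field
    task : Job
    slot : ℕ
open Timed

jobs : List Timed → Instance
jobs = map task

completion : (P : List Timed) → Schedule (jobs P)
completion (p ∷ P) zero    = slot p
completion (p ∷ P) (suc i) = completion P i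

entry : (P : List Timed) → Fin (length (jobs P)) → Timed
entry P i = lookup (jobs P) i at completion P i

Released : Timed → Set
Released p = rel (task p) < slot p

Compatible : Timed → Timed → Set
Compatible p q = slot p ≡ slot q → Disjoint (task p) (task q)

lateness : Timed → ℕ
lateness p = slot p ∸ rel (task p)

flow : List Timed → ℕ
flow P = sum (map lateness P)

disjoint-sym : ∀ {a b} → Disjoint a b → Disjoint b a
disjoint-sym (ss , sd , ds , dd) = ss ∘ sym , ds ∘ sym , sd ∘ sym , dd ∘ sym

compatible-sym : ∀ {p q} → Compatible p q → Compatible q p
compatible-sym {p} {q} c e = disjoint-sym {task p} {task q} (c (sym e))

All-entry : ∀ {Q : Timed → Set} {P} → All Q P → ∀ i → Q (entry P i)
All-entry (q ∷ _)  zero    = q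
All-entry (_ ∷ qs) (suc i) = All-entry qs i

matching : ∀ {P} → AllPairs Compatible P → ∀ i j → i ≢ j →
           completion P i ≡ completion P j →
           Disjoint (lookup (jobs P) i) (lookup (jobs P) j)
matching         (_ ∷ _)  zero    zero    i≢j = ⊥-elim (i≢j refl)
matching         (c ∷ _)  zero    (suc j) _   = All-entry c j
matching {p ∷ P} (c ∷ _)  (suc i) zero    _   = compatible-sym {p} {entry P i} (All-entry c i)
matching         (_ ∷ cs) (suc i) (suc j) i≢j = matching cs i j (i≢j ∘ cong suc)

flowTime-completion : ∀ P → flowTime (jobs P) (completion P) ≡ flow P
flowTime-completion []      = refl
flowTime-completion (p ∷ P) = cong (lateness p +_) (flowTime-completion P)

timed-schedule : ∀ {J B} (P : List Timed) → jobs P ≡ J →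
                 All Released P → AllPairs Compatible P → flow P ≤ B →
                 OptAtMost J B
timed-schedule P refl released compatible flow≤B =
  completion P , (All-entry released , matching compatible) ,
  subst (_≤ _) (sym (flowTime-completion P)) flow≤B

flow-++ : ∀ P Q → flow (P ++ Q) ≡ flow P + flow Q
flow-++ P Q = trans (cong sum (map-++ lateness P Q)) (sum-++ (map lateness P) (map lateness Q))

sum-applyUpTo-≤ : ∀ {b} (f : ℕ → ℕ) n → (∀ {k} → k < n → f k ≤ b) →
                  sum (applyUpTo f n) ≤ n * b
sum-applyUpTo-≤ f zero    _     = z≤n
sum-applyUpTo-≤ f (suc n) f≤b = +-mono-≤ (f≤b z<s) (sum-applyUpTo-≤ (f ∘ suc) n (f≤b ∘ s<s))

Cross : List Timed → List Timed → Set
Cross P Q = All (λ p → All (Compatible p) Q) P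

cross-++ : ∀ {P Q R} → Cross P Q → Cross P R → Cross P (Q ++ R)
cross-++ PQ PR = All.zipWith (λ (q , r) → All.++⁺ q r) (PQ , PR)

segment : (ℕ → Job) → (t n : ℕ) → List Timed
segment j t n = applyUpTo (λ k → j k at (t + k)) n

segment-jobs : ∀ j t n → jobs (segment j t n) ≡ applyUpTo j n
segment-jobs j t n = map-applyUpTo _ task n

segment-released : ∀ {j t} n → (∀ k → rel (j k) < t + k) → All Released (segment j t n)
segment-released n = All.applyUpTo⁺₂ _ n

-- Jobs of one segment occupy distinct slots.
segment-compatible : ∀ j t n → AllPairs Compatible (segment j t n)
segment-compatible j t n = AllPairs.applyUpTo⁺₁ _ n
  (λ k<k′ _ e → ⊥-elim (<⇒≢ k<k′ (+-cancelˡ-≡ t _ _ e)))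

segment-flow : ∀ {b} j t n → (∀ {k} → k < n → t + k ∸ rel (j k) ≤ b) →
               flow (segment j t n) ≤ n * b
segment-flow j t n late≤b = subst (_≤ _) (sym (cong sum (map-applyUpTo _ lateness n)))
  (sum-applyUpTo-≤ _ n late≤b)

segments-cross : ∀ {j j′ t t′ n n′} →
                 (∀ {k k′} → k < n → k′ < n′ → Compatible (j k at (t + k)) (j′ k′ at (t′ + k′))) →
                 Cross (segment j t n) (segment j′ t′ n′)
segments-cross {n = n} {n′} compatible =
  All.applyUpTo⁺₁ _ n (λ k<n → All.applyUpTo⁺₁ _ n′ (compatible k<n))

slot-before : ∀ {t n t′ k} k′ → t + n ≤ t′ → k < n → t + k < t′ + k′
slot-before {t} {t′ = t′} k′ end≤t′ k<n =
  <-≤-trans (+-monoʳ-< t k<n) (≤-trans end≤t′ (m≤m+n t′ k′))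

segments-apart : ∀ {j j′ t t′ n n′} → t + n ≤ t′ ⊎ t′ + n′ ≤ t →
                 Cross (segment j t n) (segment j′ t′ n′)
segments-apart (inj₁ end≤t′) = segments-cross
  λ {k} {k′} k<n _ e → ⊥-elim (<⇒≢ (slot-before k′ end≤t′ k<n) e)
segments-apart (inj₂ end′≤t) = segments-cross
  λ {k} {k′} _ k′<n′ e → ⊥-elim (<⇒≢ (slot-before k end′≤t k′<n′) (sym e))

segments-disjoint : ∀ {j j′ t t′ n n′} → (∀ k k′ → Disjoint (j k) (j′ k′)) →
                    Cross (segment j t n) (segment j′ t′ n′)
segments-disjoint disjoint = segments-cross λ {k} {k′} _ _ _ → disjoint k k′

compatible₃ : ∀ {X Y Z} → Cross X Y → Cross X Z → Cross Y Z →
              AllPairs Compatible X → AllPairs Compatible Y → AllPairs Compatible Z →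
              AllPairs Compatible (X ++ Y ++ Z)
compatible₃ XY XZ YZ X Y Z = AllPairs.++⁺ X (AllPairs.++⁺ Y Z YZ) (cross-++ XY XZ)

applyUpTo-const : ∀ {A : Set} (x : A) n → applyUpTo (λ _ → x) n ≡ replicate n x
applyUpTo-const x zero    = refl
applyUpTo-const x (suc n) = cong (x ∷_) (applyUpTo-const x n)

jobs-++₃ : ∀ {A B C} X Y Z → jobs X ≡ A → jobs Y ≡ B → jobs Z ≡ C →
           jobs (X ++ Y ++ Z) ≡ A ++ B ++ C
jobs-++₃ X Y Z refl refl refl =
  trans (map-++ task X (Y ++ Z)) (cong (jobs X ++_) (map-++ task Y Z))

total-budget : ∀ s → s * (2 + s + s) + (s * (2 + s + s) + s * s * 1) + 6 * s ≡ 5 * (s * s + 2 * s)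
total-budget = solve-∀

module Schedules (s : ℕ) where

  block : Node → ℕ → List Timed
  block a t = segment (λ _ → job a v₂ 1) t s

  early late : Node → List Timed
  early a = block a 2
  late a = block a (2 + s)

  streamJob : Node → ℕ → Job
  streamJob a i = job a v₄ (s + suc i)

  stream : Node → List Timed
  stream a = segment (streamJob a) (2 + s) (s * s)

  block-jobs : ∀ a t → jobs (block a t) ≡ replicate s (job a v₂ 1)
  block-jobs a t = trans (segment-jobs _ t s) (applyUpTo-const _ s)

  stream-jobs : ∀ a → jobs (stream a) ≡ map (streamJob a) (upTo (s * s))
  stream-jobs a = trans (segment-jobs _ _ (s * s)) (sym (map-upTo _ (s * s)))

  block-released : ∀ a t → 2 ≤ t → All Released (block a t)
  block-released a t 2≤t = segment-released s λ k → ≤-trans 2≤t (m≤m+n t k)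

  stream-released : ∀ a → All Released (stream a)
  stream-released a = segment-released (s * s) λ k → s≤s (≤-reflexive (+-suc s k))

  -- A block job finishes by slot 2s+1, so its flow time is at most 2s+2.
  block-flow : ∀ a t → t ≤ 2 + s → flow (block a t) ≤ s * (2 + s + s)
  block-flow a t t≤ = segment-flow _ t s λ k<s → ≤-trans (m∸n≤m _ 1) (+-mono-≤ t≤ (<⇒≤ k<s))

  stream-flow : ∀ a → flow (stream a) ≤ s * s * 1
  stream-flow a = segment-flow _ (2 + s) (s * s) λ {k} _ → ≤-reflexive (begin
      2 + s + k ∸ (s + suc k)   ≡⟨ cong (2 + s + k ∸_) (+-suc s k) ⟩
      1 + suc (s + k) ∸ suc (s + k) ≡⟨ m+n∸n≡m 1 (suc (s + k)) ⟩
      1                         ∎)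
    where open ≡-Reasoning

  flow-budget : ∀ X Y Z → flow X ≤ s * (2 + s + s) → flow Y ≤ s * (2 + s + s) →
                flow Z ≤ s * s * 1 → flow (X ++ Y ++ Z) ≤ 5 * numJobs s
  flow-budget X Y Z fX fY fZ = begin
      flow (X ++ Y ++ Z)          ≡⟨ trans (flow-++ X (Y ++ Z)) (cong (flow X +_) (flow-++ Y Z)) ⟩
      flow X + (flow Y + flow Z)  ≤⟨ +-mono-≤ fX (+-mono-≤ fY fZ) ⟩
      s * (2 + s + s) + (s * (2 + s + s) + s * s * 1)  ≤⟨ m≤m+n _ (6 * s) ⟩
      s * (2 + s + s) + (s * (2 + s + s) + s * s * 1) + 6 * s  ≡⟨ total-budget s ⟩
      5 * numJobs s               ∎
    where open ≤-Reasoning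

  early-before-late : ∀ a b → Cross (early a) (late b)
  early-before-late a b = segments-apart (inj₁ ≤-refl)

  late-after-early : ∀ a b → Cross (late a) (early b)
  late-after-early a b = segments-apart (inj₂ ≤-refl)

  early-before-stream : ∀ a b → Cross (early a) (stream b)
  early-before-stream a b = segments-apart (inj₁ ≤-refl)

  -- The late block shares its slots with the stream, so it must be
  -- endpoint-disjoint from it.
  late-beside-stream : ∀ a b → (∀ r → Disjoint (job a v₂ 1) (job b v₄ r)) →
                       Cross (late a) (stream b)
  late-beside-stream a b disjoint = segments-disjoint λ _ k′ → disjoint (s + suc k′)


  T₁-bound : OptAtMost (T₁ s) (5 * numJobs s)
  T₁-bound = timed-schedule (late v₁ ++ early v₃ ++ stream v₃)
    (jobs-++₃ (late v₁) (early v₃) (stream v₃) (block-jobs v₁ _) (block-jobs v₃ 2) (stream-jobs v₃))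
    (All.++⁺ (block-released v₁ _ (m≤m+n 2 s)) (All.++⁺ (block-released v₃ 2 ≤-refl) (stream-released v₃)))
    (compatible₃ (late-after-early v₁ v₃)
                 (late-beside-stream v₁ v₃ λ _ → (λ ()) , (λ ()) , (λ ()) , (λ ()))
                 (early-before-stream v₃ v₃)
                 (segment-compatible _ _ s) (segment-compatible _ 2 s) (segment-compatible _ _ (s * s)))
    (flow-budget (late v₁) (early v₃) (stream v₃)
      (block-flow v₁ _ ≤-refl) (block-flow v₃ 2 (m≤m+n 2 s)) (stream-flow v₃))

  T₂-bound : OptAtMost (T₂ s) (5 * numJobs s)
  T₂-bound = timed-schedule (early v₁ ++ late v₃ ++ stream v₁)
    (jobs-++₃ (early v₁) (late v₃) (stream v₁) (block-jobs v₁ 2) (block-jobs v₃ _) (stream-jobs v₁))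
    (All.++⁺ (block-released v₁ 2 ≤-refl) (All.++⁺ (block-released v₃ _ (m≤m+n 2 s)) (stream-released v₁)))
    (compatible₃ (early-before-late v₁ v₃)
                 (early-before-stream v₁ v₁)
                 (late-beside-stream v₃ v₁ λ _ → (λ ()) , (λ ()) , (λ ()) , (λ ()))
                 (segment-compatible _ 2 s) (segment-compatible _ _ s) (segment-compatible _ _ (s * s)))
    (flow-budget (early v₁) (late v₃) (stream v₁)
      (block-flow v₁ 2 (m≤m+n 2 s)) (block-flow v₃ _ ≤-refl) (stream-flow v₁))

lemma13 : ∃[ C ] ∃[ L₀ ] (∀ (s : ℕ) → L₀ ≤ s * s → 2 ∣ s * s →
    OptAtMost (T₁ s) (C * numJobs s) × OptAtMost (T₂ s) (C * numJobs s))
lemma13 = 5 , 0 , λ s _ _ → Schedules.T₁-bound s , Schedules.T₂-bound s
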